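{- Let $r\in\mathbb{N}$, let $k\in\mathbb{N}$ with $k>\lceil\log_2 r\rceil$, and let $y_1,\dots,y_r\in\mathbb{Z}$ with $\sum_{i=1}^{r}y_i=0$. Put $l=\max_i\big(\lceil\log_2|y_i|\rceil+\lceil\log_2 r\rceil\big)$. Then for every $j=0,1,\dots,\lfloor l/k\rfloor$ we have $\big|\sum_{i=1}^{r}P^k_j(y_i)\big|<r \bmod 2^k$.
   Context: For $k\in\mathbb{N}$ and $j\in\mathbb{N}\cup\{0\}$, the map $P^k_j:\mathbb{Z}\to\mathbb{Z}$ is defined by $P^k_j(z)=\mathrm{sign}(z)\,z_j$, where $|z|=\sum_{i\ge 0}z_i2^{ik}$ with $0\le z_i<2^k$ is the base-$2^k$ expansion of $|z|$ (so $P^k_j(z)$ is the $j$-th base-$2^k$ digit of $|z|$, carrying the sign of $z$; $\mathrm{sign}(0)=0$). For an integer $x$, the notation "$|x|<r \bmod 2^k$" means that $x$ is congruent modulo $2^k$ to some integer $c$ with $|c|<r$. $\lceil\cdot\rceil$ and $\lfloor\cdot\rfloor$ are the ceiling and floor functions. -}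

module Defs where

open import Data.Nat as ℕ using (ℕ; zero; suc; _^_; _*_; _⊔_)
open import Data.Nat.DivMod using (_/_; _%_)
open import Data.Nat.Properties using (m^n≢0)
open import Data.Integer as ℤ using (ℤ; +_; -[1+_]; -_; ∣_∣)
open import Data.Integer.Divisibility using (_∣_)
open import Data.Fin using (Fin; zero; suc)
open import Data.Product using (∃; _×_)

digit : ℕ → ℕ → ℕ → ℕ
digit k j n = _%_ (_/_ n (2 ^ (j * k)) {{m^n≢0 2 (j * k)}}) (2 ^ k) {{m^n≢0 2 k}}

P : ℕ → ℕ → ℤ → ℤ
P k j (+ n)      = + digit k j n
P k j -[1+ n ]   = - (+ digit k j (suc n))

sumℤ : ∀ {r} → (Fin r → ℤ) → ℤ
sumℤ {zero}  f = + 0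
sumℤ {suc r} f = f zero ℤ.+ sumℤ (λ i → f (suc i))

maxℕ : ∀ {r} → (Fin r → ℕ) → ℕ
maxℕ {zero}  f = 0
maxℕ {suc r} f = f zero ⊔ maxℕ (λ i → f (suc i))

-- "|x| < r mod 2^k": x ≡ c (mod 2^k) for some integer c with |c| < r
AbsLtMod : ℤ → ℕ → ℕ → Set
AbsLtMod x r k = ∃ λ (c : ℤ) → (∣ c ∣ ℕ.< r) × (+ (2 ^ k) ∣ (x ℤ.- c))

-- Write y = signed(|y| mod m) + m · signed(|y| div m) with m = 2^(jk), so that the
-- high parts Y(y) := signed(|y| div m) satisfy Σ y = Σ (low parts) + m · Σ Y(y). When
-- Σ y = 0, the r low parts, each of absolute value below m, force |Σ Y(y)| < r. The
-- j-th digit P^k_j(y) is the low part of Y(y) with respect to 2^k, hence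
-- Σ P^k_j(y) ≡ Σ Y(y) (mod 2^k), and c = Σ Y(y) witnesses the claim.
-- This works for every j and k.
module Submission where

open import Defs
open import Data.Nat using (ℕ; _≤_; _<_; _+_; NonZero)
open import Data.Nat.DivMod using (_/_)
open import Data.Nat.Logarithm using (⌈log₂_⌉)
open import Data.Integer using (ℤ; +_; ∣_∣)
open import Data.Fin using (Fin)
open import Relation.Binary.PropositionalEquality using (_≡_)

open import Data.Nat using (_^_)
import Data.Nat as ℕ
import Data.Nat.Properties as ℕ
import Data.Nat.Divisibility as ℕ
open import Data.Nat.DivMod using (_%_; m≡m%n+[m/n]*n; m%n<n)
open import Data.Integer using (-[1+_]; -_; _-_)
open import Data.Integer.Properties
  using (pos-+; pos-*; neg-distrib-+; neg-distribʳ-*; *-zeroʳ; +-identityˡ; ∣-i∣≡∣i∣; abs-*; ∣i+j∣≤∣i∣+∣j∣)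
import Data.Integer as ℤ
open import Data.Integer.Divisibility using (_∣_)
open import Data.Integer.Tactic.RingSolver using (solve-∀)
open import Data.Fin using (zero; suc)
open import Data.Product using (_,_)
open import Function using (_∘_)
open import Relation.Binary.PropositionalEquality
  using (refl; sym; trans; cong; cong₂; subst; subst₂; module ≡-Reasoning)

signed : ℤ → ℕ → ℤ
signed (+ _)    n = + n
signed -[1+ _ ] n = - (+ n)

signed-+ : ∀ y m n → signed y (m ℕ.+ n) ≡ signed y m ℤ.+ signed y n
signed-+ (+ _)    m n = pos-+ m n
signed-+ -[1+ _ ] m n = trans (cong -_ (pos-+ m n)) (neg-distrib-+ (+ m) (+ n))

signed-* : ∀ y m n → signed y (m ℕ.* n) ≡ + m ℤ.* signed y n
signed-* (+ _)    m n = pos-* m n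
signed-* -[1+ _ ] m n = trans (cong -_ (pos-* m n)) (neg-distribʳ-* (+ m) (+ n))

∣signed∣ : ∀ y n → ∣ signed y n ∣ ≡ n
∣signed∣ (+ _)    n = refl
∣signed∣ -[1+ _ ] n = ∣-i∣≡∣i∣ (+ n)

signed-∣∣ : ∀ y → signed y ∣ y ∣ ≡ y
signed-∣∣ (+ _)    = refl
signed-∣∣ -[1+ _ ] = refl

P≡signed-digit : ∀ k j y → P k j y ≡ signed y (digit k j ∣ y ∣)
P≡signed-digit k j (+ _)    = refl
P≡signed-digit k j -[1+ _ ] = refl

signed-divMod : ∀ y n d .{{_ : NonZero d}} →
  signed y n ≡ signed y (n % d) ℤ.+ + d ℤ.* signed y (n / d)
signed-divMod y n d = begin
  signed y n                                  ≡⟨ cong (signed y) (m≡m%n+[m/n]*n n d) ⟩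
  signed y (n % d ℕ.+ n / d ℕ.* d)            ≡⟨ cong (λ q → signed y (n % d ℕ.+ q)) (ℕ.*-comm (n / d) d) ⟩
  signed y (n % d ℕ.+ d ℕ.* (n / d))          ≡⟨ signed-+ y (n % d) _ ⟩
  signed y (n % d) ℤ.+ signed y (d ℕ.* (n / d)) ≡⟨ cong (λ t → signed y (n % d) ℤ.+ t) (signed-* y d _) ⟩
  signed y (n % d) ℤ.+ + d ℤ.* signed y (n / d) ∎
  where open ≡-Reasoning

sumℤ-cong : ∀ {r} {f g : Fin r → ℤ} → (∀ i → f i ≡ g i) → sumℤ f ≡ sumℤ g
sumℤ-cong {ℕ.zero}  f≡g = refl
sumℤ-cong {ℕ.suc r} f≡g = cong₂ ℤ._+_ (f≡g zero) (sumℤ-cong (f≡g ∘ suc))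

sumℤ-+-* : ∀ {r} (f : Fin r → ℤ) c (g : Fin r → ℤ) →
  sumℤ (λ i → f i ℤ.+ c ℤ.* g i) ≡ sumℤ f ℤ.+ c ℤ.* sumℤ g
sumℤ-+-* {ℕ.zero}  f c g = sym (trans (+-identityˡ (c ℤ.* + 0)) (*-zeroʳ c))
sumℤ-+-* {ℕ.suc r} f c g = begin
  (f zero ℤ.+ c ℤ.* g zero) ℤ.+ sumℤ (λ i → f (suc i) ℤ.+ c ℤ.* g (suc i))
    ≡⟨ cong (λ t → (f zero ℤ.+ c ℤ.* g zero) ℤ.+ t) (sumℤ-+-* (f ∘ suc) c (g ∘ suc)) ⟩
  (f zero ℤ.+ c ℤ.* g zero) ℤ.+ (sumℤ (f ∘ suc) ℤ.+ c ℤ.* sumℤ (g ∘ suc))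
    ≡⟨ rearrange (f zero) (g zero) (sumℤ (f ∘ suc)) (sumℤ (g ∘ suc)) c ⟩
  (f zero ℤ.+ sumℤ (f ∘ suc)) ℤ.+ c ℤ.* (g zero ℤ.+ sumℤ (g ∘ suc)) ∎
  where
    open ≡-Reasoning
    rearrange : ∀ a b s t c → (a ℤ.+ c ℤ.* b) ℤ.+ (s ℤ.+ c ℤ.* t) ≡ (a ℤ.+ s) ℤ.+ c ℤ.* (b ℤ.+ t)
    rearrange = solve-∀

∣sumℤ∣≤ : ∀ {r} B (f : Fin r → ℤ) → (∀ i → ∣ f i ∣ ≤ B) → ∣ sumℤ f ∣ ≤ r ℕ.* B
∣sumℤ∣≤ {ℕ.zero}  B f bound = ℕ.z≤n
∣sumℤ∣≤ {ℕ.suc r} B f bound = ℕ.≤-trans (∣i+j∣≤∣i∣+∣j∣ (f zero) _)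
  (ℕ.+-mono-≤ (bound zero) (∣sumℤ∣≤ B (f ∘ suc) (bound ∘ suc)))

∣sumℤ∣< : ∀ {r} B (f : Fin (ℕ.suc r) → ℤ) → (∀ i → ∣ f i ∣ < B) →
  ∣ sumℤ f ∣ < ℕ.suc r ℕ.* B
∣sumℤ∣< B f bound = ℕ.<-≤-trans (ℕ.≤-<-trans (∣i+j∣≤∣i∣+∣j∣ (f zero) _)
  (ℕ.+-mono-<-≤ (bound zero) (∣sumℤ∣≤ B (f ∘ suc) (ℕ.<⇒≤ ∘ bound ∘ suc)))) ℕ.≤-refl

a+d*b≡0⇒∣a∣≡d*∣b∣ : ∀ a d b → a ℤ.+ + d ℤ.* b ≡ + 0 → ∣ a ∣ ≡ d ℕ.* ∣ b ∣
a+d*b≡0⇒∣a∣≡d*∣b∣ a d b a+db≡0 = begin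
  ∣ a ∣                               ≡⟨ cong ∣_∣ (isolate a (+ d ℤ.* b)) ⟩
  ∣ (a ℤ.+ + d ℤ.* b) - + d ℤ.* b ∣   ≡⟨ cong (λ s → ∣ s - + d ℤ.* b ∣) a+db≡0 ⟩
  ∣ + 0 - + d ℤ.* b ∣                 ≡⟨ cong ∣_∣ (+-identityˡ (- (+ d ℤ.* b))) ⟩
  ∣ - (+ d ℤ.* b) ∣                   ≡⟨ ∣-i∣≡∣i∣ (+ d ℤ.* b) ⟩
  ∣ + d ℤ.* b ∣                       ≡⟨ abs-* (+ d) b ⟩
  d ℕ.* ∣ b ∣                         ∎
  where
    open ≡-Reasoning
    isolate : ∀ a c → a ≡ (a ℤ.+ c) - c
    isolate = solve-∀

c≡x+d*s⇒d∣x-c : ∀ x c d s → c ≡ x ℤ.+ + d ℤ.* s → + d ∣ x - c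
c≡x+d*s⇒d∣x-c x c d s c≡x+ds = subst (d ℕ.∣_) (sym ∣x-c∣≡d∣s∣) (ℕ.m∣m*n ∣ s ∣)
  where
    open ≡-Reasoning
    cancel : ∀ x t → x - (x ℤ.+ t) ≡ - t
    cancel = solve-∀
    ∣x-c∣≡d∣s∣ : ∣ x - c ∣ ≡ d ℕ.* ∣ s ∣
    ∣x-c∣≡d∣s∣ = begin
      ∣ x - c ∣                   ≡⟨ cong (λ t → ∣ x - t ∣) c≡x+ds ⟩
      ∣ x - (x ℤ.+ + d ℤ.* s) ∣   ≡⟨ cong ∣_∣ (cancel x (+ d ℤ.* s)) ⟩
      ∣ - (+ d ℤ.* s) ∣           ≡⟨ ∣-i∣≡∣i∣ (+ d ℤ.* s) ⟩
      ∣ + d ℤ.* s ∣               ≡⟨ abs-* (+ d) s ⟩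
      d ℕ.* ∣ s ∣                 ∎

module _ {r : ℕ} (y : Fin r → ℤ) where

  signedQuotient : (d : ℕ) .{{_ : NonZero d}} → Fin r → ℤ
  signedQuotient d i = signed (y i) (∣ y i ∣ / d)

  sumℤ-quotients-small : 1 ≤ r → (d : ℕ) .{{_ : NonZero d}} → sumℤ y ≡ + 0 →
    ∣ sumℤ (signedQuotient d) ∣ < r
  sumℤ-quotients-small (ℕ.s≤s ℕ.z≤n) d Σy≡0 =
    ℕ.*-cancelˡ-< d _ _ (subst₂ _<_ ∣low∣≡d∣high∣ (ℕ.*-comm r d) ∣low∣<rd)
    where
      low : Fin r → ℤ
      low i = signed (y i) (∣ y i ∣ % d)
      low+d*high≡0 : sumℤ low ℤ.+ + d ℤ.* sumℤ (signedQuotient d) ≡ + 0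
      low+d*high≡0 = begin
        sumℤ low ℤ.+ + d ℤ.* sumℤ (signedQuotient d)
          ≡⟨ sumℤ-+-* low (+ d) (signedQuotient d) ⟨
        sumℤ (λ i → low i ℤ.+ + d ℤ.* signedQuotient d i)
          ≡⟨ sumℤ-cong (λ i → trans (sym (signed-∣∣ (y i))) (signed-divMod (y i) ∣ y i ∣ d)) ⟨
        sumℤ y
          ≡⟨ Σy≡0 ⟩
        + 0 ∎
        where open ≡-Reasoning
      ∣low∣≡d∣high∣ : ∣ sumℤ low ∣ ≡ d ℕ.* ∣ sumℤ (signedQuotient d) ∣
      ∣low∣≡d∣high∣ = a+d*b≡0⇒∣a∣≡d*∣b∣ (sumℤ low) d (sumℤ (signedQuotient d)) low+d*high≡0
      ∣low∣<rd : ∣ sumℤ low ∣ < r ℕ.* d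
      ∣low∣<rd = ∣sumℤ∣< d low (λ i → subst (_< d) (sym (∣signed∣ (y i) _)) (m%n<n ∣ y i ∣ d))

  sumℤ-digits≡sumℤ-quotients-mod : (k j : ℕ) →
    + (2 ^ k) ∣ sumℤ (λ i → P k j (y i)) - sumℤ (signedQuotient (2 ^ (j ℕ.* k)) {{ℕ.m^n≢0 2 (j ℕ.* k)}})
  sumℤ-digits≡sumℤ-quotients-mod k j =
    c≡x+d*s⇒d∣x-c (sumℤ (λ i → P k j (y i))) (sumℤ (signedQuotient m)) (2 ^ k) (sumℤ higher) (begin
    sumℤ (signedQuotient m)
      ≡⟨ sumℤ-cong (λ i → trans (signed-divMod (y i) (∣ y i ∣ / m) (2 ^ k))
                               (cong (λ t → t ℤ.+ + (2 ^ k) ℤ.* higher i) (sym (P≡signed-digit k j (y i))))) ⟩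
    sumℤ (λ i → P k j (y i) ℤ.+ + (2 ^ k) ℤ.* higher i)
      ≡⟨ sumℤ-+-* (λ i → P k j (y i)) (+ (2 ^ k)) higher ⟩
    sumℤ (λ i → P k j (y i)) ℤ.+ + (2 ^ k) ℤ.* sumℤ higher ∎)
    where
      open ≡-Reasoning
      m : ℕ
      m = 2 ^ (j ℕ.* k)
      instance
        m≢0 : NonZero m
        m≢0 = ℕ.m^n≢0 2 (j ℕ.* k)
        2^k≢0 : NonZero (2 ^ k)
        2^k≢0 = ℕ.m^n≢0 2 k
      higher : Fin r → ℤ
      higher i = signed (y i) (∣ y i ∣ / m / 2 ^ k)

lemma2 : (r : ℕ) → 1 ≤ r → (k : ℕ) .{{_ : NonZero k}} → ⌈log₂ r ⌉ < k →
    (y : Fin r → ℤ) → sumℤ y ≡ + 0 →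
    (j : ℕ) → j ≤ maxℕ (λ i → ⌈log₂ ∣ y i ∣ ⌉ + ⌈log₂ r ⌉) / k →
    AbsLtMod (sumℤ (λ i → P k j (y i))) r k
lemma2 r 1≤r k _ y Σy≡0 j _ =
  sumℤ (signedQuotient y (2 ^ (j ℕ.* k))) ,
  sumℤ-quotients-small y 1≤r (2 ^ (j ℕ.* k)) Σy≡0 ,
  sumℤ-digits≡sumℤ-quotients-mod y k j
  where
    instance
      2^jk≢0 : NonZero (2 ^ (j ℕ.* k))
      2^jk≢0 = ℕ.m^n≢0 2 (j ℕ.* k)
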